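{- Let $a,b,c>1$ be pairwise relatively prime integers, and let $c_1$ be a divisor of $c$ with $c_1>2$ and $\gcd(c_1,\varphi(c_1))=1$. Assume $e_{c_1}(a)=e_{c_1}(b)=:E_1$, and for $h\in\{a,b\}$ let $\delta_h\in\{1,-1\}$ be defined by $h^{E_1}\equiv\delta_h\pmod{c_1}$. Suppose $(x,y,z)\neq(X,Y,Z)$ are two solutions in positive integers of $a^x+b^y=c^z$ with $z\le Z$, and put $\Delta=|xY-Xy|$. Then: (i) $a^{\Delta}\equiv(-1)^{y+Y}\pmod{c^z}$ and $b^{\Delta}\equiv(-1)^{x+X}\pmod{c^z}$; (ii) $\Delta\equiv0\pmod{E_1}$; (iii) $\gcd(a^{E_1}-\delta_a,\,b^{E_1}-\delta_b)\cdot \Delta/E_1\equiv 0\pmod{c_1^{\,z}}$.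
   Context: For a positive integer $M$ and an integer $A$ coprime to $M$, $e_M(A)$ denotes the least positive integer $e$ with $A^e\equiv\pm1\pmod M$ (extended multiplicative order). $\varphi$ is Euler's totient function. -}

module Defs where

open import Data.Nat as ℕ using (ℕ; zero; suc; _<_)
open import Data.Nat.GCD using (gcd)
open import Data.Integer as ℤ using (ℤ; +_; _-_; -_; _^_)
open import Data.Integer.Divisibility using (_∣_)
open import Data.Product using (_×_)
open import Data.Sum using (_⊎_)
open import Relation.Nullary using (¬_; yes; no)
open import Relation.Binary.PropositionalEquality using (_≡_)

infix 4 _≡_[mod_]
_≡_[mod_] : ℤ → ℤ → ℕ → Set
A ≡ B [mod M ] = + M ∣ (A - B)

countCoprime : ℕ → ℕ → ℕ
countCoprime n zero = zero
countCoprime n (suc k) with gcd (suc k) n ℕ.≟ 1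
... | yes _ = suc (countCoprime n k)
... | no  _ = countCoprime n k

φ : ℕ → ℕ
φ n = countCoprime n n

PowPM1 : ℕ → ℤ → ℕ → Set
PowPM1 M A e = (A ^ e ≡ + 1 [mod M ]) ⊎ (A ^ e ≡ - + 1 [mod M ])

IsExtOrder : ℕ → ℤ → ℕ → Set
IsExtOrder M A e =
  (0 < e) × PowPM1 M A e × (∀ e′ → 0 < e′ → e′ < e → ¬ PowPM1 M A e′)

-- (i) Modulo c^z the two solutions give a^x ≡ -b^y and a^X ≡ -b^Y. Raising them to the
-- powers Y and y gives (-1)^y a^(xY) ≡ (-1)^Y a^(Xy), and cancelling the smaller power of a,
-- a unit modulo c^z, leaves a^Δ ≡ ±1; symmetrically for b.
-- (ii) Then also a^(Δ mod E₁) ≡ ±1 (mod c₁), so the remainder vanishes by minimality of E₁.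
-- (iii) c₁ is odd, because φ(n) is even for even n > 2 (i ↦ n - i pairs the units below n/2 with
-- those above it). Put 1 + w = δ_a a^E₁, so that c₁ ∣ w and (1 + w)^(Δ/E₁) ≡ ±1 (mod c₁^z); the sign
-- is +1 since c₁ > 2. A prime-free lifting-the-exponent lemma then gives c₁^z ∣ w Δ/E₁: for odd
-- N ∣ w, N^z ∣ (1 + w)^t - 1 implies N^z ∣ w t, by strong induction on t. If gcd(N, t) = 1, then
-- (1 + w)^t - 1 = w G with G ≡ t (mod w), a unit modulo N. Otherwise g = gcd(N, t) is odd and
-- divides w, so the binomial expansion modulo w³ gives (1 + w)^g = 1 + g w U with U ≡ 1 (mod w),
-- and (w, t) can be replaced by (g w U, t/g). The same for b, combined through gcd, gives (iii).

module Submission where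

open import Defs

module Parity where
  open import Data.Nat
  open import Data.Nat.Properties
  open import Data.Nat.Divisibility
  open import Data.Nat.GCD using (gcd; gcd-greatest)
  open import Data.Nat.Coprimality using (gcd≡1⇒coprime; coprime⇒gcd≡1)
  open import Data.Nat.Tactic.RingSolver using (solve-∀)
  open import Data.Nat.DivMod using (m%n<n; m≡m%n+[m/n]*n)
  open import Data.Nat.Combinatorics using (_C_; nC1≡n; nCk+nC[k+1]≡[n+1]C[k+1])
  open import Data.Product using (∃-syntax; _,_)
  open import Relation.Binary.PropositionalEquality
  open import Relation.Nullary using (¬_; yes; no; contradiction)

  coprimeIndicator : ℕ → ℕ → ℕ
  coprimeIndicator n i with gcd i n ≟ 1
  ... | yes _ = 1
  ... | no  _ = 0

  countCoprime-suc : ∀ n k →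
    countCoprime n (suc k) ≡ coprimeIndicator n (suc k) + countCoprime n k
  countCoprime-suc n k with gcd (suc k) n ≟ 1
  ... | yes _ = refl
  ... | no  _ = refl

  coprimeIndicator-≡0 : ∀ {n i e} → e ∣ i → e ∣ n → e ≢ 1 → coprimeIndicator n i ≡ 0
  coprimeIndicator-≡0 {n} {i} e∣i e∣n e≢1 with gcd i n ≟ 1
  ... | yes gcd≡1 = contradiction (gcd≡1⇒coprime {i} gcd≡1 (e∣i , e∣n)) e≢1
  ... | no  _     = refl

  gcd-reflect : ∀ {n} i j → i + j ≡ n → gcd i n ≡ 1 → gcd j n ≡ 1
  gcd-reflect i j refl gcd[i,n]≡1 = coprime⇒gcd≡1 {j} {i + j} λ {d} (d∣j , d∣n) →
    gcd≡1⇒coprime {i} gcd[i,n]≡1 (∣m+n∣m⇒∣n (subst (d ∣_) (+-comm i j) d∣n) d∣j , d∣n)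

  coprimeIndicator-reflect : ∀ {n} i j → i + j ≡ n →
    coprimeIndicator n i ≡ coprimeIndicator n j
  coprimeIndicator-reflect {n} i j eq with gcd i n ≟ 1 | gcd j n ≟ 1
  ... | yes _   | yes _   = refl
  ... | no  _   | no  _   = refl
  ... | yes i≡1 | no  j≢1 = contradiction (gcd-reflect i j eq i≡1) j≢1
  ... | no  i≢1 | yes j≡1 = contradiction (gcd-reflect j i (trans (+-comm j i) eq) j≡1) i≢1

  -- i ↦ n - i maps {1, …, j} onto {i, …, n - 1}; the indicators correct the two endpoints.
  countCoprime-reflect : ∀ {n} i j → i + j ≡ n →
    countCoprime n i + countCoprime n j + coprimeIndicator n 0 ≡ φ n + coprimeIndicator n i
  countCoprime-reflect         zero    j refl = refl
  countCoprime-reflect {n = n} (suc i) j eq = begin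
      countCoprime n (suc i) + c j + χ 0       ≡⟨ cong (λ k → k + c j + χ 0) (countCoprime-suc n i) ⟩
      χ (suc i) + c i + c j + χ 0              ≡⟨ shuffle (χ (suc i)) (c i) (c j) (χ 0) ⟩
      χ (suc i) + (c i + c j + χ 0)            ≡⟨ cong (χ (suc i) +_) rest ⟩
      χ (suc i) + φ n                          ≡⟨ +-comm (χ (suc i)) (φ n) ⟩
      φ n + χ (suc i)                          ∎
    where
    open ≡-Reasoning
    c = countCoprime n
    χ = coprimeIndicator n
    shuffle : ∀ a b d e → a + b + d + e ≡ a + (b + d + e)
    shuffle = solve-∀
    i+[1+j]≡n : i + suc j ≡ n
    i+[1+j]≡n = trans (+-suc i j) eq
    rest : c i + c j + χ 0 ≡ φ n
    rest = +-cancelˡ-≡ (χ i) _ _ (begin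
      χ i + (c i + c j + χ 0)       ≡⟨ rearrange (χ i) (c i) (c j) (χ 0) ⟩
      c i + (χ i + c j) + χ 0       ≡⟨ cong (λ k → c i + (k + c j) + χ 0)
                                          (coprimeIndicator-reflect i (suc j) i+[1+j]≡n) ⟩
      c i + (χ (suc j) + c j) + χ 0 ≡⟨ cong (λ k → c i + k + χ 0) (sym (countCoprime-suc n j)) ⟩
      c i + c (suc j) + χ 0         ≡⟨ countCoprime-reflect i (suc j) i+[1+j]≡n ⟩
      φ n + χ i                     ≡⟨ +-comm (φ n) (χ i) ⟩
      χ i + φ n                     ∎)
      where
      rearrange : ∀ a b d e → a + (b + d + e) ≡ b + (a + d) + e
      rearrange = solve-∀

  φ-even : ∀ {n} → 2 < n → 2 ∣ n → 2 ∣ φ n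
  φ-even {n} 2<n (divides m n≡m*2) = divides (c m) (begin
      φ n                  ≡⟨ +-identityʳ (φ n) ⟨
      φ n + 0              ≡⟨ cong (φ n +_) (coprimeIndicator-≡0 ∣-refl m∣n m≢1) ⟨
      φ n + χ m            ≡⟨ countCoprime-reflect m m m+m≡n ⟨
      c m + c m + χ 0      ≡⟨ cong (c m + c m +_) (coprimeIndicator-≡0 (n ∣0) ∣-refl n≢1) ⟩
      c m + c m + 0        ≡⟨ double (c m) ⟩
      c m * 2              ∎)
    where
    open ≡-Reasoning
    c = countCoprime n
    χ = coprimeIndicator n
    double : ∀ k → k + k + 0 ≡ k * 2
    double = solve-∀
    m+m≡n : m + m ≡ n
    m+m≡n = trans (sym (+-identityʳ (m + m))) (trans (double m) (sym n≡m*2))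
    m∣n : m ∣ n
    m∣n = divides 2 (trans n≡m*2 (*-comm m 2))
    n≢1 : n ≢ 1
    n≢1 refl = contradiction 2<n λ { (s≤s ()) }
    m≢1 : m ≢ 1
    m≢1 refl = <-irrefl (sym n≡m*2) 2<n

  gcd[n,φn]≡1⇒¬2∣n : ∀ {n} → 2 < n → gcd n (φ n) ≡ 1 → ¬ 2 ∣ n
  gcd[n,φn]≡1⇒¬2∣n {n} 2<n gcd≡1 2∣n =
    contradiction (∣1⇒≡1 (subst (2 ∣_) gcd≡1 (gcd-greatest 2∣n (φ-even 2<n 2∣n)))) λ ()

  ¬2∣⇒≡1+2h : ∀ {n} → ¬ 2 ∣ n → ∃[ h ] n ≡ suc (2 * h)
  ¬2∣⇒≡1+2h {n} ¬2∣n with n % 2 | m%n<n n 2 | m≡m%n+[m/n]*n n 2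
  ... | 0 | _ | n≡[n/2]*2 = contradiction (divides (n / 2) n≡[n/2]*2) ¬2∣n
  ... | 1 | _ | n≡1+[n/2]*2 = n / 2 , trans n≡1+[n/2]*2 (cong suc (*-comm (n / 2) 2))
  ... | suc (suc _) | s≤s (s≤s ()) | _

  suc-C2 : ∀ n → suc n C 2 ≡ n + n C 2
  suc-C2 n = trans (sym (nCk+nC[k+1]≡[n+1]C[k+1] n 1)) (cong (_+ n C 2) (nC1≡n n))

  [1+2h]C2≡[1+2h]*h : ∀ h → suc (2 * h) C 2 ≡ suc (2 * h) * h
  [1+2h]C2≡[1+2h]*h zero    = refl
  [1+2h]C2≡[1+2h]*h (suc h) = begin
    suc (2 * suc h) C 2                       ≡⟨ cong (λ k → suc k C 2) (*-suc 2 h) ⟩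
    suc (suc g) C 2                           ≡⟨ suc-C2 (suc g) ⟩
    suc g + suc g C 2                         ≡⟨ cong (suc g +_) (suc-C2 g) ⟩
    suc g + (g + g C 2)                       ≡⟨ cong (λ k → suc g + (g + k)) ([1+2h]C2≡[1+2h]*h h) ⟩
    suc g + (g + g * h)                       ≡⟨ expand h ⟩
    suc (2 * suc h) * suc h                   ∎
    where
    open ≡-Reasoning
    g = suc (2 * h)
    expand : ∀ h → suc (suc (2 * h)) + (suc (2 * h) + suc (2 * h) * h) ≡ suc (2 * suc h) * suc h
    expand = solve-∀

module PowerCongruences where
  open Parity using (¬2∣⇒≡1+2h; [1+2h]C2≡[1+2h]*h; suc-C2)
  open import Data.Nat as ℕ using (ℕ; zero; suc; _<_)
  import Data.Nat.Properties as ℕ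
  import Data.Nat.DivMod as ℕ
  open import Data.Nat.Divisibility using (_∣_)
  import Data.Nat.Divisibility as ℕ
  open import Data.Nat.Coprimality as Coprimality using (Coprime)
  open import Data.Nat.GCD using (gcd; gcd[m,n]∣m; gcd[m,n]∣n; gcd-greatest; c*gcd[m,n]≡gcd[cm,cn])
  open import Data.Nat.Combinatorics using (_C_)
  open import Data.Nat.Induction using (<-wellFounded)
  import Data.Nat.Tactic.RingSolver as NatSolver
  open import Data.Integer using (ℤ; +_; -_; _+_; _-_; _*_; _^_; ∣_∣; 0ℤ; 1ℤ; -1ℤ)
  open import Data.Integer.Properties
    using (abs-*; +-inverseʳ; +-identityʳ; *-comm; pos-+; pos-*; *-identityˡ; ^-zeroˡ; ^-distribˡ-+-*; ^-*-assoc)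
  import Data.Integer.Divisibility.Signed as Signed
  import Data.Integer.GCD as ℤ
  open import Data.Integer.Tactic.RingSolver using (solve-∀)
  open import Data.Product using (∃-syntax; _×_; _,_)
  open import Data.Sum using (_⊎_; inj₁; inj₂)
  open import Induction.WellFounded using (Acc; acc)
  open import Level using (0ℓ)
  open import Relation.Binary.Bundles using (Setoid)
  import Relation.Binary.Reasoning.Setoid as ≈-Reasoning
  open import Relation.Binary.PropositionalEquality
  open import Relation.Nullary using (¬_; yes; no; contradiction)
  open import Relation.Nullary.Decidable using (decidable-stable)

  private
    variable
      M N : ℕ
      A B A′ B′ : ℤ

  pos-^ : ∀ m n → + (m ℕ.^ n) ≡ (+ m) ^ n
  pos-^ m zero    = refl
  pos-^ m (suc n) = trans (pos-* m (m ℕ.^ n)) (cong (+ m *_) (pos-^ m n))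

  abs-^ : ∀ A n → ∣ A ^ n ∣ ≡ ∣ A ∣ ℕ.^ n
  abs-^ A zero    = refl
  abs-^ A (suc n) = trans (abs-* A (A ^ n)) (cong (∣ A ∣ ℕ.*_) (abs-^ A n))

  ^-distrib-* : ∀ A B n → (A * B) ^ n ≡ A ^ n * B ^ n
  ^-distrib-* A B zero    = refl
  ^-distrib-* A B (suc n) = trans (cong (A * B *_) (^-distrib-* A B n)) (interchange A B (A ^ n) (B ^ n))
    where
    interchange : ∀ a b c d → a * b * (c * d) ≡ a * c * (b * d)
    interchange = solve-∀

  neg-^ : ∀ A n → (- A) ^ n ≡ -1ℤ ^ n * A ^ n
  neg-^ A n = trans (cong (_^ n) (neg≡-1* A)) (^-distrib-* -1ℤ A n)
    where
    neg≡-1* : ∀ a → - a ≡ -1ℤ * a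
    neg≡-1* = solve-∀

  coprime-^ʳ : ∀ {m n} k → Coprime m n → Coprime m (n ℕ.^ k)
  coprime-^ʳ zero    _        (_ , d∣1)     = ℕ.∣1⇒≡1 d∣1
  coprime-^ʳ (suc k) coprime {d} (d∣m , d∣n*nᵏ) =
    coprime-^ʳ k coprime (d∣m , Coprimality.coprime-divisor d⊥n d∣n*nᵏ)
    where
    d⊥n : Coprime d _
    d⊥n (e∣d , e∣n) = coprime (ℕ.∣-trans e∣d d∣m , e∣n)

  coprime-^ˡ : ∀ {m n} k → Coprime m n → Coprime (m ℕ.^ k) n
  coprime-^ˡ k coprime = Coprimality.sym (coprime-^ʳ k (Coprimality.sym coprime))

  coprime-abs-^ : ∀ n → Coprime M ∣ A ∣ → Coprime M ∣ A ^ n ∣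
  coprime-abs-^ {A = A} n coprime = subst (Coprime _) (sym (abs-^ A n)) (coprime-^ʳ n coprime)

  ^-monoˡ-∣ : ∀ {m n} k → m ∣ n → m ℕ.^ k ∣ n ℕ.^ k
  ^-monoˡ-∣ zero    _   = ℕ.∣-refl
  ^-monoˡ-∣ (suc k) m∣n = ℕ.*-pres-∣ m∣n (^-monoˡ-∣ k m∣n)

  n∣n^k : ∀ {n k} → 0 < k → n ∣ n ℕ.^ k
  n∣n^k {k = suc _} _ = ℕ.m∣m*n _

  ^-monoʳ-∣ : ∀ m {j k} → j ℕ.≤ k → m ℕ.^ j ∣ m ℕ.^ k
  ^-monoʳ-∣ m {j} {k} j≤k = subst (m ℕ.^ j ∣_) mʲ*mᵏ⁻ʲ≡mᵏ (ℕ.m∣m*n (m ℕ.^ (k ℕ.∸ j)))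
    where
    mʲ*mᵏ⁻ʲ≡mᵏ : m ℕ.^ j ℕ.* m ℕ.^ (k ℕ.∸ j) ≡ m ℕ.^ k
    mʲ*mᵏ⁻ʲ≡mᵏ = trans (sym (ℕ.^-distribˡ-+-* m j (k ℕ.∸ j))) (cong (m ℕ.^_) (ℕ.m+[n∸m]≡n j≤k))

  -- _≡_[mod_] unfolds to divisibility of ∣ A - B ∣, from which Agda cannot infer A and B;
  -- wrapping it in a record keeps them as indices.
  infix 4 _≈_[mod_]
  record _≈_[mod_] (A B : ℤ) (M : ℕ) : Set where
    constructor wrap
    field unwrap : A ≡ B [mod M ]
  open _≈_[mod_] public

  private
    toSigned : A ≈ B [mod M ] → + M Signed.∣ A - B
    toSigned (wrap M∣A-B) = Signed.∣ᵤ⇒∣ M∣A-B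

    fromSigned : + M Signed.∣ A - B → A ≈ B [mod M ]
    fromSigned M∣A-B = wrap (Signed.∣⇒∣ᵤ M∣A-B)

    signed-subst : ∀ {K X Y} → X ≡ Y → K Signed.∣ X → K Signed.∣ Y
    signed-subst refl K∣X = K∣X

  mod-refl : A ≈ A [mod M ]
  mod-refl {A = A} {M = M} = wrap (subst (λ X → M ∣ ∣ X ∣) (sym (+-inverseʳ A)) (M ℕ.∣0))

  mod-sym : A ≈ B [mod M ] → B ≈ A [mod M ]
  mod-sym {A = A} {B = B} A≈B = fromSigned (signed-subst (neg-sub A B) (Signed.∣m⇒∣-m (toSigned A≈B)))
    where
    neg-sub : ∀ a b → - (a - b) ≡ b - a
    neg-sub = solve-∀

  mod-trans : A ≈ A′ [mod M ] → A′ ≈ B [mod M ] → A ≈ B [mod M ]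
  mod-trans {A = A} {A′ = A′} {B = B} A≈A′ A′≈B =
    fromSigned (signed-subst (split A A′ B) (Signed.∣m∣n⇒∣m+n (toSigned A≈A′) (toSigned A′≈B)))
    where
    split : ∀ a b c → (a - b) + (b - c) ≡ a - c
    split = solve-∀

  mod-setoid : ℕ → Setoid 0ℓ 0ℓ
  mod-setoid M = record
    { Carrier       = ℤ
    ; _≈_           = _≈_[mod M ]
    ; isEquivalence = record { refl = mod-refl ; sym = mod-sym ; trans = mod-trans }
    }

  mod-* : A ≈ B [mod M ] → A′ ≈ B′ [mod M ] → A * A′ ≈ B * B′ [mod M ]
  mod-* {A = A} {B = B} {A′ = A′} {B′ = B′} A≈B A′≈B′ = fromSigned (signed-subst (split A B A′ B′)
    (Signed.∣m∣n⇒∣m+n (Signed.∣n⇒∣m*n A (toSigned A′≈B′)) (Signed.∣m⇒∣m*n B′ (toSigned A≈B))))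
    where
    split : ∀ a b c d → a * (c - d) + (a - b) * d ≡ a * c - b * d
    split = solve-∀

  mod-*ˡ : ∀ K → A ≈ B [mod M ] → K * A ≈ K * B [mod M ]
  mod-*ˡ K = mod-* (mod-refl {A = K})

  mod-^ : ∀ n → A ≈ B [mod M ] → A ^ n ≈ B ^ n [mod M ]
  mod-^ zero    A≈B = mod-refl
  mod-^ (suc n) A≈B = mod-* A≈B (mod-^ n A≈B)

  mod-∣ : N ∣ M → A ≈ B [mod M ] → A ≈ B [mod N ]
  mod-∣ N∣M (wrap M∣A-B) = wrap (ℕ.∣-trans N∣M M∣A-B)

  mod-cancelˡ : ∀ K → Coprime M ∣ K ∣ → K * A ≈ K * B [mod M ] → A ≈ B [mod M ]
  mod-cancelˡ {M = M} {A = A} {B = B} K coprime (wrap M∣KA-KB) =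
    wrap (Coprimality.coprime-divisor coprime
      (subst (M ∣_) (trans (cong ∣_∣ (factor K A B)) (abs-* K (A - B))) M∣KA-KB))
    where
    factor : ∀ c a b → c * a - c * b ≡ c * (a - b)
    factor = solve-∀

  mod-coprime : A ≈ B [mod M ] → Coprime M ∣ B ∣ → Coprime M ∣ A ∣
  mod-coprime {A = A} {B = B} A≈B coprime {d} (d∣M , d∣A) = coprime (d∣M , Signed.∣⇒∣ᵤ d∣B)
    where
    sub-sub : ∀ a b → a - (a - b) ≡ b
    sub-sub = solve-∀
    d∣B : + d Signed.∣ B
    d∣B = signed-subst (sub-sub A B) (Signed.∣m∣n⇒∣m-n (Signed.∣ᵤ⇒∣ {+ d} {A} d∣A)
      (Signed.∣-trans (Signed.∣ᵤ⇒∣ {+ d} {+ _} d∣M) (toSigned A≈B)))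

  private
    ≈-by-multiple : ∀ w X → A - B ≡ w * X → A ≈ B [mod ∣ w ∣ ]
    ≈-by-multiple w X A-B≡wX = wrap (Signed.∣⇒∣ᵤ (Signed.divides X (trans A-B≡wX (*-comm w X))))

  1+X≈1⇒∣X∣ : ∀ {X} → 1ℤ + X ≈ 1ℤ [mod M ] → M ∣ ∣ X ∣
  1+X≈1⇒∣X∣ {M = M} {X} (wrap M∣[1+X]-1) = subst (λ Y → M ∣ ∣ Y ∣) (cancel X) M∣[1+X]-1
    where
    cancel : ∀ x → 1ℤ + x - 1ℤ ≡ x
    cancel = solve-∀

  pow-sum⇒≈-neg : ∀ a b x y → M ∣ a ℕ.^ x ℕ.+ b ℕ.^ y → (+ a) ^ x ≈ - ((+ b) ^ y) [mod M ]
  pow-sum⇒≈-neg {M = M} a b x y M∣sum = wrap (subst (λ X → M ∣ ∣ X ∣) sum≡difference M∣sum)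
    where
    sub-neg : ∀ u v → u + v ≡ u - (- v)
    sub-neg = solve-∀
    sum≡difference : + (a ℕ.^ x ℕ.+ b ℕ.^ y) ≡ (+ a) ^ x - (- ((+ b) ^ y))
    sum≡difference = trans (pos-+ (a ℕ.^ x) (b ℕ.^ y))
      (trans (cong₂ _+_ (pos-^ a x) (pos-^ b y)) (sub-neg ((+ a) ^ x) ((+ b) ^ y)))

  IsSign : ℤ → Set
  IsSign s = s ≡ 1ℤ ⊎ s ≡ -1ℤ

  sign-* : ∀ {s t} → IsSign s → IsSign t → IsSign (s * t)
  sign-* (inj₁ refl) (inj₁ refl) = inj₁ refl
  sign-* (inj₁ refl) (inj₂ refl) = inj₂ refl
  sign-* (inj₂ refl) (inj₁ refl) = inj₂ refl
  sign-* (inj₂ refl) (inj₂ refl) = inj₁ refl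

  sign-^ : ∀ {s} n → IsSign s → IsSign (s ^ n)
  sign-^ zero    _      = inj₁ refl
  sign-^ (suc n) s-sign = sign-* s-sign (sign-^ n s-sign)

  -1^-sign : ∀ n → IsSign (-1ℤ ^ n)
  -1^-sign n = sign-^ n (inj₂ refl)

  ∣sign∣≡1 : ∀ {s} → IsSign s → ∣ s ∣ ≡ 1
  ∣sign∣≡1 (inj₁ refl) = refl
  ∣sign∣≡1 (inj₂ refl) = refl

  sign-cancel : ∀ {s} → IsSign s → ∀ A → s * (s * A) ≡ A
  sign-cancel (inj₁ refl) A = trans (*-identityˡ (1ℤ * A)) (*-identityˡ A)
  sign-cancel (inj₂ refl) A = cancel A
    where
    cancel : ∀ a → -1ℤ * (-1ℤ * a) ≡ a
    cancel = solve-∀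

  PowPM1⇒≈sign : ∀ {e} → PowPM1 M A e → ∃[ s ] IsSign s × A ^ e ≈ s [mod M ]
  PowPM1⇒≈sign (inj₁ A^e≡1)  = 1ℤ  , inj₁ refl , wrap A^e≡1
  PowPM1⇒≈sign (inj₂ A^e≡-1) = -1ℤ , inj₂ refl , wrap A^e≡-1

  ≈sign⇒PowPM1 : ∀ {e s} → IsSign s → A ^ e ≈ s [mod M ] → PowPM1 M A e
  ≈sign⇒PowPM1 (inj₁ refl) (wrap A^e≡1)  = inj₁ A^e≡1
  ≈sign⇒PowPM1 (inj₂ refl) (wrap A^e≡-1) = inj₂ A^e≡-1

  -- Two solutions of a^x + b^y ≡ 0

  ^-*-≈-neg : ∀ p q → A ^ p ≈ - (B ^ q) [mod M ] → ∀ r →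
              A ^ (p ℕ.* r) ≈ -1ℤ ^ r * B ^ (q ℕ.* r) [mod M ]
  ^-*-≈-neg {A = A} {B = B} {M = M} p q Aᵖ≈-Bᵠ r = begin
    A ^ (p ℕ.* r)             ≡⟨ ^-*-assoc A p r ⟨
    (A ^ p) ^ r               ≈⟨ mod-^ r Aᵖ≈-Bᵠ ⟩
    (- (B ^ q)) ^ r           ≡⟨ neg-^ (B ^ q) r ⟩
    -1ℤ ^ r * (B ^ q) ^ r     ≡⟨ cong (-1ℤ ^ r *_) (^-*-assoc B q r) ⟩
    -1ℤ ^ r * B ^ (q ℕ.* r)   ∎
    where open ≈-Reasoning (mod-setoid M)

  private
    signed-pow-cancel-≤ : ∀ m n {p q} → q ℕ.≤ p → Coprime M ∣ A ∣ →
      -1ℤ ^ m * A ^ p ≈ -1ℤ ^ n * A ^ q [mod M ] → A ^ (p ℕ.∸ q) ≈ -1ℤ ^ (m ℕ.+ n) [mod M ]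
    signed-pow-cancel-≤ {M = M} {A = A} m n {p} {q} q≤p coprime hyp = begin
      A ^ d                       ≡⟨ sign-cancel (-1^-sign m) (A ^ d) ⟨
      σ m * (σ m * A ^ d)         ≈⟨ mod-*ˡ (σ m) (mod-cancelˡ (A ^ q) (coprime-abs-^ q coprime) Aᵠ*σᵐAᵈ≈Aᵠ*σⁿ) ⟩
      σ m * σ n                   ≡⟨ ^-distribˡ-+-* -1ℤ m n ⟨
      σ (m ℕ.+ n)                 ∎
      where
      open ≈-Reasoning (mod-setoid M)
      σ = -1ℤ ^_
      d = p ℕ.∸ q
      rearrange : ∀ s a b → a * (s * b) ≡ s * (a * b)
      rearrange = solve-∀
      Aᵠ*σᵐAᵈ≈Aᵠ*σⁿ : A ^ q * (σ m * A ^ d) ≈ A ^ q * σ n [mod M ]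
      Aᵠ*σᵐAᵈ≈Aᵠ*σⁿ = begin
        A ^ q * (σ m * A ^ d)     ≡⟨ rearrange (σ m) (A ^ q) (A ^ d) ⟩
        σ m * (A ^ q * A ^ d)     ≡⟨ cong (σ m *_) (^-distribˡ-+-* A q d) ⟨
        σ m * A ^ (q ℕ.+ d)       ≡⟨ cong (λ e → σ m * A ^ e) (ℕ.m+[n∸m]≡n q≤p) ⟩
        σ m * A ^ p               ≈⟨ hyp ⟩
        σ n * A ^ q               ≡⟨ *-comm (σ n) (A ^ q) ⟩
        A ^ q * σ n               ∎

  signed-pow-cancel : ∀ m n p q → Coprime M ∣ A ∣ →
    -1ℤ ^ m * A ^ p ≈ -1ℤ ^ n * A ^ q [mod M ] → A ^ ℕ.∣ p - q ∣ ≈ -1ℤ ^ (m ℕ.+ n) [mod M ]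
  signed-pow-cancel {M = M} {A = A} m n p q coprime hyp with ℕ.≤-total q p
  ... | inj₁ q≤p = subst (λ e → A ^ e ≈ _ [mod M ]) (sym (ℕ.m≤n⇒∣n-m∣≡n∸m q≤p))
                     (signed-pow-cancel-≤ m n q≤p coprime hyp)
  ... | inj₂ p≤q = subst₂ (λ e k → A ^ e ≈ -1ℤ ^ k [mod M ])
                     (sym (ℕ.m≤n⇒∣m-n∣≡n∸m p≤q)) (ℕ.+-comm n m)
                     (signed-pow-cancel-≤ n m p≤q coprime (mod-sym hyp))

  ≈-neg-pair⇒pow-≈-sign : ∀ x y X Y → Coprime M ∣ A ∣ →
    A ^ x ≈ - (B ^ y) [mod M ] → A ^ X ≈ - (B ^ Y) [mod M ] →
    A ^ ℕ.∣ x ℕ.* Y - X ℕ.* y ∣ ≈ -1ℤ ^ (y ℕ.+ Y) [mod M ]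
  ≈-neg-pair⇒pow-≈-sign {M = M} {A = A} {B = B} x y X Y coprime Aˣ≈-Bʸ Aˣ≈-Bʸ′ =
    signed-pow-cancel y Y (x ℕ.* Y) (X ℕ.* y) coprime (begin
      σ y * A ^ (x ℕ.* Y)               ≈⟨ mod-*ˡ (σ y) (^-*-≈-neg x y Aˣ≈-Bʸ Y) ⟩
      σ y * (σ Y * B ^ (y ℕ.* Y))       ≡⟨ swap (σ y) (σ Y) (B ^ (y ℕ.* Y)) ⟩
      σ Y * (σ y * B ^ (y ℕ.* Y))       ≡⟨ cong (λ e → σ Y * (σ y * B ^ e)) (ℕ.*-comm y Y) ⟩
      σ Y * (σ y * B ^ (Y ℕ.* y))       ≈⟨ mod-*ˡ (σ Y) (^-*-≈-neg X Y Aˣ≈-Bʸ′ y) ⟨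
      σ Y * A ^ (X ℕ.* y)               ∎)
    where
    open ≈-Reasoning (mod-setoid M)
    σ = -1ℤ ^_
    swap : ∀ s t b → s * (t * b) ≡ t * (s * b)
    swap = solve-∀

  two-solutions⇒pow-≈-sign : ∀ a b x y X Y → Coprime a M → Coprime b M →
    M ∣ a ℕ.^ x ℕ.+ b ℕ.^ y → M ∣ a ℕ.^ X ℕ.+ b ℕ.^ Y →
    (+ a) ^ ℕ.∣ x ℕ.* Y - X ℕ.* y ∣ ≈ -1ℤ ^ (y ℕ.+ Y) [mod M ] ×
    (+ b) ^ ℕ.∣ x ℕ.* Y - X ℕ.* y ∣ ≈ -1ℤ ^ (x ℕ.+ X) [mod M ]
  two-solutions⇒pow-≈-sign {M = M} a b x y X Y a⊥M b⊥M M∣sum M∣sum′ =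
    ≈-neg-pair⇒pow-≈-sign x y X Y (Coprimality.sym a⊥M) (pow-sum⇒≈-neg a b x y M∣sum) (pow-sum⇒≈-neg a b X Y M∣sum′) ,
    subst (λ e → (+ b) ^ e ≈ -1ℤ ^ (x ℕ.+ X) [mod M ]) Δ-swap
      (≈-neg-pair⇒pow-≈-sign y x Y X (Coprimality.sym b⊥M)
        (pow-sum⇒≈-neg b a y x (swap (a ℕ.^ x) M∣sum)) (pow-sum⇒≈-neg b a Y X (swap (a ℕ.^ X) M∣sum′)))
    where
    swap : ∀ u {v} → M ∣ u ℕ.+ v → M ∣ v ℕ.+ u
    swap u {v} = subst (M ∣_) (ℕ.+-comm u v)
    Δ-swap : ℕ.∣ y ℕ.* X - Y ℕ.* x ∣ ≡ ℕ.∣ x ℕ.* Y - X ℕ.* y ∣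
    Δ-swap = trans (cong₂ ℕ.∣_-_∣ (ℕ.*-comm y X) (ℕ.*-comm Y x)) (ℕ.∣-∣-comm (X ℕ.* y) (x ℕ.* Y))

  -- The extended order

  extOrder-∣ : ∀ {E n} → IsExtOrder M A E → PowPM1 M A n → E ∣ n
  extOrder-∣ {M = M} {A = A} {E} {n} (0<E , Aᴱ≈±1 , minimal) Aⁿ≈±1
    with PowPM1⇒≈sign {A = A} {e = E} Aᴱ≈±1 | PowPM1⇒≈sign {A = A} {e = n} Aⁿ≈±1
  ... | σ , σ-sign , Aᴱ≈σ | τ , τ-sign , Aⁿ≈τ =
    ℕ.m%n≡0⇒n∣m n E (decidable-stable (r ℕ.≟ 0) λ r≢0 →
      minimal r (ℕ.n≢0⇒n>0 r≢0) (ℕ.m%n<n n E) (≈sign⇒PowPM1 {A = A} {e = r} (sign-* τ-sign (sign-^ q σ-sign)) Aʳ≈τσ^q))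
    where
    instance E≢0 = ℕ.>-nonZero 0<E
    r = n ℕ.% E
    q = n ℕ./ E
    Aⁿ≡[Aᴱ]^q*Aʳ : A ^ n ≡ (A ^ E) ^ q * A ^ r
    Aⁿ≡[Aᴱ]^q*Aʳ = begin
      A ^ n                   ≡⟨ cong (A ^_) (ℕ.m≡m%n+[m/n]*n n E) ⟩
      A ^ (r ℕ.+ q ℕ.* E)     ≡⟨ cong (λ e → A ^ (r ℕ.+ e)) (ℕ.*-comm q E) ⟩
      A ^ (r ℕ.+ E ℕ.* q)     ≡⟨ ^-distribˡ-+-* A r (E ℕ.* q) ⟩
      A ^ r * A ^ (E ℕ.* q)   ≡⟨ cong (A ^ r *_) (^-*-assoc A E q) ⟨
      A ^ r * (A ^ E) ^ q     ≡⟨ *-comm (A ^ r) ((A ^ E) ^ q) ⟩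
      (A ^ E) ^ q * A ^ r     ∎
      where open ≡-Reasoning
    Aʳ≈τσ^q : A ^ r ≈ τ * σ ^ q [mod M ]
    Aʳ≈τσ^q = begin
      A ^ r                          ≡⟨ sign-cancel (sign-^ q σ-sign) (A ^ r) ⟨
      σ ^ q * (σ ^ q * A ^ r)        ≈⟨ mod-*ˡ (σ ^ q) (mod-* (mod-^ q (mod-sym Aᴱ≈σ)) (mod-refl {A = A ^ r})) ⟩
      σ ^ q * ((A ^ E) ^ q * A ^ r)  ≡⟨ cong (σ ^ q *_) Aⁿ≡[Aᴱ]^q*Aʳ ⟨
      σ ^ q * A ^ n                  ≈⟨ mod-*ˡ (σ ^ q) Aⁿ≈τ ⟩
      σ ^ q * τ                      ≡⟨ *-comm (σ ^ q) τ ⟩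
      τ * σ ^ q                      ∎
      where open ≈-Reasoning (mod-setoid M)

  -- Lifting the exponent

  binomial-mod-cube : ∀ w n →
    ∃[ k ] (1ℤ + w) ^ n ≡ 1ℤ + + n * w + + (n C 2) * (w * w) + k * (w * w * w)
  binomial-mod-cube w zero    = 0ℤ , vanish w
    where
    vanish : ∀ w → 1ℤ ≡ 1ℤ + 0ℤ * w + 0ℤ * (w * w) + 0ℤ * (w * w * w)
    vanish = solve-∀
  binomial-mod-cube w (suc n) with binomial-mod-cube w n
  ... | k , expansion = k′ , (begin
    (1ℤ + w) * (1ℤ + w) ^ n
      ≡⟨ cong ((1ℤ + w) *_) expansion ⟩
    (1ℤ + w) * (1ℤ + + n * w + + (n C 2) * (w * w) + k * (w * w * w))
      ≡⟨ step (+ n) (+ (n C 2)) k w ⟩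
    1ℤ + (1ℤ + + n) * w + (+ n + + (n C 2)) * (w * w) + k′ * (w * w * w)
      ≡⟨ cong (λ c → 1ℤ + + suc n * w + + c * (w * w) + k′ * (w * w * w)) (suc-C2 n) ⟨
    1ℤ + + suc n * w + + (suc n C 2) * (w * w) + k′ * (w * w * w) ∎)
    where
    open ≡-Reasoning
    k′ = + (n C 2) + k + k * w
    step : ∀ n c k w → (1ℤ + w) * (1ℤ + n * w + c * (w * w) + k * (w * w * w))
                     ≡ 1ℤ + (1ℤ + n) * w + (n + c) * (w * w) + (c + k + k * w) * (w * w * w)
    step = solve-∀

  binomial-mod-square : ∀ w n → ∃[ G ] (1ℤ + w) ^ n ≡ 1ℤ + w * G × G ≈ + n [mod ∣ w ∣ ]
  binomial-mod-square w n with binomial-mod-cube w n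
  ... | k , expansion = + n + w * R , trans expansion (regroup (+ n) (+ (n C 2)) k w) ,
                        ≈-by-multiple w R (cancel (+ n) (w * R))
    where
    R = + (n C 2) + k * w
    regroup : ∀ n c k w → 1ℤ + n * w + c * (w * w) + k * (w * w * w) ≡ 1ℤ + w * (n + w * (c + k * w))
    regroup = solve-∀
    cancel : ∀ n x → n + x - n ≡ x
    cancel = solve-∀

  binomial-odd : ∀ {w g} → ¬ 2 ∣ g → g ∣ ∣ w ∣ →
    ∃[ U ] (1ℤ + w) ^ g ≡ 1ℤ + + g * w * U × U ≈ 1ℤ [mod ∣ w ∣ ]
  binomial-odd {w} {g} odd g∣w with ¬2∣⇒≡1+2h odd | Signed.∣ᵤ⇒∣ {+ g} {w} g∣w
  ... | h , refl | Signed.divides v w≡v*g with binomial-mod-cube w g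
  ... | k , expansion = U , Aᵍ≡1+gwU , ≈-by-multiple w (+ h + k * v) (cancel _)
    where
    U = 1ℤ + w * (+ h + k * v)
    cancel : ∀ x → 1ℤ + x - 1ℤ ≡ x
    cancel = solve-∀
    factor : ∀ g h w v k → 1ℤ + g * w + g * h * (w * w) + k * (w * w * (v * g))
                         ≡ 1ℤ + g * w * (1ℤ + w * (h + k * v))
    factor = solve-∀
    Aᵍ≡1+gwU : (1ℤ + w) ^ g ≡ 1ℤ + + g * w * U
    Aᵍ≡1+gwU = begin
      (1ℤ + w) ^ g
        ≡⟨ expansion ⟩
      1ℤ + + g * w + + (g C 2) * (w * w) + k * (w * w * w)
        ≡⟨ cong (λ c → 1ℤ + + g * w + + c * (w * w) + k * (w * w * w)) ([1+2h]C2≡[1+2h]*h h) ⟩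
      1ℤ + + g * w + + (g ℕ.* h) * (w * w) + k * (w * w * w)
        ≡⟨ cong₂ (λ c u → 1ℤ + + g * w + c * (w * w) + k * (w * w * u)) (pos-* g h) w≡v*g ⟩
      1ℤ + + g * w + + g * + h * (w * w) + k * (w * w * (v * + g))
        ≡⟨ factor (+ g) (+ h) w v k ⟩
      1ℤ + + g * w * U ∎
      where open ≡-Reasoning

  LiftsExponent : ℕ → ℕ → ℕ → Set
  LiftsExponent N z t = ∀ w → N ∣ ∣ w ∣ → (1ℤ + w) ^ t ≈ 1ℤ [mod N ℕ.^ z ] → N ℕ.^ z ∣ ∣ w ∣ ℕ.* t

  lifting-exponent-coprime : ∀ z {t} → Coprime N t → LiftsExponent N z t
  lifting-exponent-coprime {N = N} z {t} N⊥t w N∣w hyp with binomial-mod-square w t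
  ... | G , expansion , G≈t = ℕ.∣m⇒∣m*n t (Coprimality.coprime-divisor Nᶻ⊥G
    (subst (N ℕ.^ z ∣_) (trans (abs-* w G) (ℕ.*-comm ∣ w ∣ ∣ G ∣))
      (1+X≈1⇒∣X∣ {X = w * G} (subst (_≈ 1ℤ [mod N ℕ.^ z ]) expansion hyp))))
    where
    Nᶻ⊥G : Coprime (N ℕ.^ z) ∣ G ∣
    Nᶻ⊥G = coprime-^ˡ z (mod-coprime (mod-∣ N∣w G≈t) N⊥t)

  lifting-exponent-odd-step : ∀ z {g t} → ¬ 2 ∣ g → g ∣ N →
    LiftsExponent N z t → LiftsExponent N z (g ℕ.* t)
  lifting-exponent-odd-step {N = N} z {g} {t} odd g∣N lifts w N∣w hyp
    with binomial-odd {w} {g} odd (ℕ.∣-trans g∣N N∣w)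
  ... | U , expansion , U≈1 =
    Coprimality.coprime-divisor Nᶻ⊥U (subst (N ℕ.^ z ∣_) regroup (lifts w′ N∣w′ [1+w′]ᵗ≈1))
    where
    w′ = + g * w * U
    ∣w′∣≡g∣w∣∣U∣ : ∣ w′ ∣ ≡ g ℕ.* ∣ w ∣ ℕ.* ∣ U ∣
    ∣w′∣≡g∣w∣∣U∣ = trans (abs-* (+ g * w) U) (cong (ℕ._* ∣ U ∣) (abs-* (+ g) w))
    N∣w′ : N ∣ ∣ w′ ∣
    N∣w′ = ℕ.∣-trans N∣w (subst (∣ w ∣ ∣_) (sym ∣w′∣≡g∣w∣∣U∣) (ℕ.∣m⇒∣m*n ∣ U ∣ (ℕ.n∣m*n g)))
    [1+w′]ᵗ≈1 : (1ℤ + w′) ^ t ≈ 1ℤ [mod N ℕ.^ z ]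
    [1+w′]ᵗ≈1 = subst (_≈ 1ℤ [mod N ℕ.^ z ])
      (trans (sym (^-*-assoc (1ℤ + w) g t)) (cong (_^ t) expansion)) hyp
    regroup : ∣ w′ ∣ ℕ.* t ≡ ∣ U ∣ ℕ.* (∣ w ∣ ℕ.* (g ℕ.* t))
    regroup = trans (cong (ℕ._* t) ∣w′∣≡g∣w∣∣U∣) (shuffle g ∣ w ∣ ∣ U ∣ t)
      where
      shuffle : ∀ g w u t → g ℕ.* w ℕ.* u ℕ.* t ≡ u ℕ.* (w ℕ.* (g ℕ.* t))
      shuffle = NatSolver.solve-∀
    Nᶻ⊥U : Coprime (N ℕ.^ z) ∣ U ∣
    Nᶻ⊥U = coprime-^ˡ z (mod-coprime (mod-∣ N∣w U≈1) (Coprimality.sym (Coprimality.1-coprimeTo N)))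

  lifting-exponent : ∀ z → ¬ 2 ∣ N → ∀ t → LiftsExponent N z t
  lifting-exponent {N = N} z odd t = lift t (<-wellFounded t)
    where
    lift : ∀ t → Acc _<_ t → LiftsExponent N z t
    lift zero _ w _ _ = subst (N ℕ.^ z ∣_) (sym (ℕ.*-zeroʳ ∣ w ∣)) ((N ℕ.^ z) ℕ.∣0)
    lift t@(suc _) (acc smaller) with gcd N t ℕ.≟ 1
    ... | yes gcd≡1 = lifting-exponent-coprime z (Coprimality.gcd≡1⇒coprime gcd≡1)
    ... | no  gcd≢1 = descend (gcd N t) (gcd[m,n]∣n N t) (gcd[m,n]∣m N t) gcd≢1
      where
      descend : ∀ g → g ∣ t → g ∣ N → g ≢ 1 → LiftsExponent N z t
      descend zero            0∣t _   _   = contradiction (ℕ.0∣⇒≡0 0∣t) λ ()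
      descend (suc zero)      _   _   1≢1 = contradiction refl 1≢1
      descend g@(suc (suc _)) g∣t g∣N _   =
        subst (LiftsExponent N z) (sym (ℕ.m∣n⇒n≡m*quotient g∣t))
          (lifting-exponent-odd-step z (λ 2∣g → odd (ℕ.∣-trans 2∣g g∣N)) g∣N
            (lift (ℕ.quotient g∣t) (smaller (ℕ.quotient-< g∣t))))

  lifting-exponent-±1 : ∀ z → 2 < N → ¬ 2 ∣ N → ∀ t {w s} → N ∣ ∣ w ∣ → IsSign s →
    (1ℤ + w) ^ t ≈ s [mod N ℕ.^ z ] → N ℕ.^ z ∣ ∣ w ∣ ℕ.* t
  lifting-exponent-±1 z       _   odd t {w} N∣w (inj₁ refl) hyp = lifting-exponent z odd t w N∣w hyp
  lifting-exponent-±1 zero    _   _   _     _   (inj₂ refl) _   = ℕ.1∣ _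
  lifting-exponent-±1 {N = N} (suc z) 2<N _ t {w} N∣w (inj₂ refl) hyp = contradiction (ℕ.∣⇒≤ N∣2) (ℕ.<⇒≱ 2<N)
    where
    1+w≈1 : 1ℤ + w ≈ 1ℤ [mod N ]
    1+w≈1 = wrap (subst (λ X → N ∣ ∣ X ∣) (sym (cancel w)) N∣w)
      where
      cancel : ∀ x → 1ℤ + x - 1ℤ ≡ x
      cancel = solve-∀
    1≈-1 : 1ℤ ≈ -1ℤ [mod N ]
    1≈-1 = begin
      1ℤ             ≡⟨ ^-zeroˡ t ⟨
      1ℤ ^ t         ≈⟨ mod-^ t 1+w≈1 ⟨
      (1ℤ + w) ^ t   ≈⟨ mod-∣ (ℕ.m∣m*n (N ℕ.^ z)) hyp ⟩
      -1ℤ            ∎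
      where open ≈-Reasoning (mod-setoid N)
    N∣2 : N ∣ 2
    N∣2 = unwrap 1≈-1

  lifting-exponent-pow : ∀ z t {E δ s} → 2 < N → ¬ 2 ∣ N → IsSign δ → A ^ E ≈ δ [mod N ] → IsSign s →
    A ^ (E ℕ.* t) ≈ s [mod N ℕ.^ z ] → N ℕ.^ z ∣ ∣ A ^ E - δ ∣ ℕ.* t
  lifting-exponent-pow {N = N} {A = A} z t {E} {δ} {s} 2<N odd δ-sign (wrap N∣Aᴱ-δ) s-sign hyp =
    subst (λ k → N ℕ.^ z ∣ k ℕ.* t) ∣w∣≡∣Aᴱ-δ∣
      (lifting-exponent-±1 z 2<N odd t {w} N∣w (sign-* (sign-^ t δ-sign) s-sign) [1+w]ᵗ≈δᵗs)
    where
    w = δ * (A ^ E - δ)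
    ∣w∣≡∣Aᴱ-δ∣ : ∣ w ∣ ≡ ∣ A ^ E - δ ∣
    ∣w∣≡∣Aᴱ-δ∣ = trans (abs-* δ (A ^ E - δ))
      (trans (cong (ℕ._* ∣ A ^ E - δ ∣) (∣sign∣≡1 δ-sign)) (ℕ.*-identityˡ ∣ A ^ E - δ ∣))
    N∣w : N ∣ ∣ w ∣
    N∣w = subst (N ∣_) (sym ∣w∣≡∣Aᴱ-δ∣) N∣Aᴱ-δ
    1+w≡δAᴱ : ∀ {δ} → IsSign δ → ∀ a → 1ℤ + δ * (a - δ) ≡ δ * a
    1+w≡δAᴱ (inj₁ refl) = solve-∀
    1+w≡δAᴱ (inj₂ refl) = solve-∀
    [1+w]ᵗ≈δᵗs : (1ℤ + w) ^ t ≈ δ ^ t * s [mod N ℕ.^ z ]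
    [1+w]ᵗ≈δᵗs = begin
      (1ℤ + w) ^ t         ≡⟨ cong (_^ t) (1+w≡δAᴱ δ-sign (A ^ E)) ⟩
      (δ * A ^ E) ^ t      ≡⟨ ^-distrib-* δ (A ^ E) t ⟩
      δ ^ t * (A ^ E) ^ t  ≡⟨ cong (δ ^ t *_) (^-*-assoc A E t) ⟩
      δ ^ t * A ^ (E ℕ.* t) ≈⟨ mod-*ˡ (δ ^ t) hyp ⟩
      δ ^ t * s            ∎
      where open ≈-Reasoning (mod-setoid (N ℕ.^ z))

  gcd-*-≈0 : ∀ U V t → M ∣ ∣ U ∣ ℕ.* t → M ∣ ∣ V ∣ ℕ.* t → ℤ.gcd U V * + t ≈ 0ℤ [mod M ]
  gcd-*-≈0 {M = M} U V t M∣Ut M∣Vt = wrap (subst (M ∣_) gcd*t≡∣gcd*t-0∣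
    (subst (M ∣_) (sym (c*gcd[m,n]≡gcd[cm,cn] t ∣ U ∣ ∣ V ∣))
      (gcd-greatest (subst (M ∣_) (ℕ.*-comm ∣ U ∣ t) M∣Ut) (subst (M ∣_) (ℕ.*-comm ∣ V ∣ t) M∣Vt))))
    where
    gcd*t≡∣gcd*t-0∣ : t ℕ.* gcd ∣ U ∣ ∣ V ∣ ≡ ∣ ℤ.gcd U V * + t - 0ℤ ∣
    gcd*t≡∣gcd*t-0∣ = trans (ℕ.*-comm t _) (sym (trans (cong ∣_∣ (+-identityʳ (ℤ.gcd U V * + t)))
                                                   (abs-* (ℤ.gcd U V) (+ t))))

open Parity using (gcd[n,φn]≡1⇒¬2∣n)
open PowerCongruences

open import Data.Nat using (ℕ; _<_; _≤_; _*_; ∣_-_∣; NonZero)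
open import Data.Nat.DivMod using (_/_; m*[n/m]≡n)
open import Data.Nat.Divisibility using (∣-refl; ∣-trans) renaming (_∣_ to _∣ℕ_)
open import Data.Nat.GCD using () renaming (gcd to gcdℕ)
open import Data.Nat.Coprimality using (Coprime)
open import Data.Integer using (ℤ; +_; -_; _-_; -1ℤ) renaming (_^_ to _^ℤ_; _*_ to _*ℤ_)
open import Data.Integer.GCD using () renaming (gcd to gcdℤ)
open import Data.Product using (_×_; _,_; proj₁; proj₂)
open import Data.Sum using (_⊎_)
open import Relation.Nullary using (¬_)
open import Relation.Binary.PropositionalEquality using (_≡_; sym; subst)

lemma4p4 : (a b c : ℕ) → 1 < a → 1 < b → 1 < c
    → Coprime a b → Coprime a c → Coprime b c
    → (c₁ : ℕ) → c₁ ∣ℕ c → 2 < c₁ → gcdℕ c₁ (φ c₁) ≡ 1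
    → (E₁ : ℕ) → .{{_ : NonZero E₁}}
    → IsExtOrder c₁ (+ a) E₁ → IsExtOrder c₁ (+ b) E₁
    → (δa δb : ℤ) → (δa ≡ + 1 ⊎ δa ≡ - + 1) → (δb ≡ + 1 ⊎ δb ≡ - + 1)
    → (+ a) ^ℤ E₁ ≡ δa [mod c₁ ] → (+ b) ^ℤ E₁ ≡ δb [mod c₁ ]
    → (x y z X Y Z : ℕ) → 0 < x → 0 < y → 0 < z → 0 < X → 0 < Y → 0 < Z
    → a Data.Nat.^ x Data.Nat.+ b Data.Nat.^ y ≡ c Data.Nat.^ z
    → a Data.Nat.^ X Data.Nat.+ b Data.Nat.^ Y ≡ c Data.Nat.^ Z
    → ¬ ((x , y , z) ≡ (X , Y , Z))
    → z ≤ Z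
    → ((+ a) ^ℤ ∣ x * Y - X * y ∣ ≡ (- + 1) ^ℤ (y Data.Nat.+ Y) [mod c Data.Nat.^ z ]
        × (+ b) ^ℤ ∣ x * Y - X * y ∣ ≡ (- + 1) ^ℤ (x Data.Nat.+ X) [mod c Data.Nat.^ z ])
      × E₁ ∣ℕ ∣ x * Y - X * y ∣
      × (gcdℤ ((+ a) ^ℤ E₁ - δa) ((+ b) ^ℤ E₁ - δb) *ℤ + (∣ x * Y - X * y ∣ / E₁)
          ≡ + 0 [mod c₁ Data.Nat.^ z ])
lemma4p4 a b c _ _ _ _ a⊥c b⊥c c₁ c₁∣c 2<c₁ gcd[c₁,φc₁]≡1 E₁ ord-a _ δa δb δa-sign δb-sign aᴱ≡δa bᴱ≡δb
         x y z X Y Z _ _ 0<z _ _ _ sol sol′ _ z≤Z =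
  (unwrap aᐞ≈± , unwrap bᐞ≈±) , E₁∣Δ ,
  unwrap (gcd-*-≈0 ((+ a) ^ℤ E₁ - δa) ((+ b) ^ℤ E₁ - δb) t (c₁ᶻ∣[hᴱ-δ]t (y Data.Nat.+ Y) δa-sign aᴱ≡δa aᐞ≈±)
                                                             (c₁ᶻ∣[hᴱ-δ]t (x Data.Nat.+ X) δb-sign bᴱ≡δb bᐞ≈±))
  where
  open Data.Nat using (_^_)
  Δ = ∣ x * Y - X * y ∣
  t = Δ / E₁
  parts-i = two-solutions⇒pow-≈-sign a b x y X Y (coprime-^ʳ z a⊥c) (coprime-^ʳ z b⊥c)
              (subst (c ^ z ∣ℕ_) (sym sol) ∣-refl) (subst (c ^ z ∣ℕ_) (sym sol′) (^-monoʳ-∣ c z≤Z))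
  aᐞ≈± = proj₁ parts-i
  bᐞ≈± = proj₂ parts-i
  E₁∣Δ : E₁ ∣ℕ Δ
  E₁∣Δ = extOrder-∣ ord-a (≈sign⇒PowPM1 {A = + a} {e = Δ} (-1^-sign (y Data.Nat.+ Y)) (mod-∣ (∣-trans c₁∣c (n∣n^k 0<z)) aᐞ≈±))
  c₁ᶻ∣[hᴱ-δ]t : ∀ {h δ} k → IsSign δ → (+ h) ^ℤ E₁ ≡ δ [mod c₁ ] → (+ h) ^ℤ Δ ≈ -1ℤ ^ℤ k [mod c ^ z ] →
                 c₁ ^ z ∣ℕ Data.Integer.∣ (+ h) ^ℤ E₁ - δ ∣ * t
  c₁ᶻ∣[hᴱ-δ]t {h} k δ-sign hᴱ≡δ hᐞ≈± =
    lifting-exponent-pow {A = + h} z t {E₁} 2<c₁ (gcd[n,φn]≡1⇒¬2∣n 2<c₁ gcd[c₁,φc₁]≡1) δ-sign (wrap hᴱ≡δ) (-1^-sign k)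
      (subst (λ e → _ ^ℤ e ≈ _ [mod c₁ ^ z ]) (sym (m*[n/m]≡n E₁∣Δ)) (mod-∣ (^-monoˡ-∣ z c₁∣c) hᐞ≈±))
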